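{- The system $\mathrm{CLC}_s$ is strongly normalizing: there is no infinite sequence of $s$-contractions $t_0\to_s t_1\to_s t_2\to_s\cdots$ of $l$-terms.
   Context: $i$-terms are ordinary terms built from variables and the constants $C,T,F,K,S$ by binary application (left-associated). $l$-terms are defined inductively: every $i$-term is an $l$-term; the labelled constants $C_1,C_2,T_1,F_1,K_1$ and $S^{n_0,\ldots,n_k}$ (for $k\ge1$ and positive integers $n_0,\ldots,n_k$) are $l$-terms; if $t_1,t_2$ are $l$-terms so is $(t_1t_2)$; if $t_1,\dots,t_n$ ($n\ge2$) are $l$-terms then the tuple $\langle t_1,\ldots,t_n\rangle$ is an $l$-term. Convention: $\langle t\rangle\equiv t$. The leftmost erasure $|t|$ of an $l$-term is obtained by replacing $C_1,C_2$ by $C$, $T_1$ by $T$, $F_1$ by $F$, $K_1$ by $K$, each $S^{\vec n}$ by $S$, and each tuple $\langle t_1,\ldots,t_n\rangle$ by (the erasure of) $t_1$. $\mathrm{CLC}$ is the conditional system on ordinary terms with rules $C\,T\,x\,y\to x$; $C\,F\,x\,y\to y$; $C\,z\,x\,y\to x \Leftarrow x=y$; $K\,x\,y\to x$; $S\,x\,y\,z\to x\,z\,(y\,z)$, where $=$ is convertibility in $\mathrm{CLC}$ itself (defined by levels: level $0$ uses the empty relation, level $n+1$ the convertibility of level $n$, and $\to_{\mathrm{CLC}}$ is the union over levels); $=_{\mathrm{CLC}}$ is its convertibility. $\mathrm{CLC}_s$ is the rewriting system on $l$-terms (rules applied in any context, including inside tuples) with rules $C_1T_1xy\to x$; $C_1F_1xy\to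 y$; $C_2zxy\to x\Leftarrow |x|=_{\mathrm{CLC}}|y|$; $C_2Txy\to x$; $C_2Fxy\to y$; $C_2T_1xy\to x$; $C_2F_1xy\to y$; $K_1xy\to x$; and, for each $S^{n_0,\ldots,n_k}$, $S^{n_0,\ldots,n_k}\,x\,\langle y_1,\ldots,y_k\rangle\,\langle z_{0,1},\ldots,z_{0,n_0},\ldots,z_{k,1},\ldots,z_{k,n_k}\rangle \to x\,\langle z_{0,1},\ldots,z_{0,n_0}\rangle\,\langle y_1\langle z_{1,1},\ldots,z_{1,n_1}\rangle,\ldots,y_k\langle z_{k,1},\ldots,z_{k,n_k}\rangle\rangle$, under the condition that $|z_{i,j}|=_{\mathrm{CLC}}|z_{i',j'}|$ for all indices and $|y_i|=_{\mathrm{CLC}}|y_j|$ for all $i,j$. A contraction by one of these rules is called an $s$-contraction, written $\to_s$. -}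

module Defs where

open import Data.Nat using (ℕ; suc)
open import Data.List using (List; []; _∷_)
open import Data.List.NonEmpty as L⁺ using (List⁺; _∷_; toList; _⁺++⁺_)
open import Data.List.Membership.Propositional using (_∈_)
open import Data.Product using (_×_; _,_; proj₁; proj₂; ∃)
open import Data.Empty using (⊥)
open import Relation.Binary.PropositionalEquality using (_≡_)
open import Relation.Binary.Construct.Closure.Equivalence using (EqClosure)

infixl 9 _·_
data ITerm : Set where
  var : ℕ → ITerm
  C T F K S : ITerm
  _·_ : ITerm → ITerm → ITerm

-- CLC, defined by levels.
-- One-step reduction (closed under application contexts), parameterised
-- by the relation used for the condition x = y of the conditional rule.

data CStep (Cond : ITerm → ITerm → Set) : ITerm → ITerm → Set where
  rCT   : ∀ x y → CStep Cond (C · T · x · y) x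
  rCF   : ∀ x y → CStep Cond (C · F · x · y) y
  rCeq  : ∀ z x y → Cond x y → CStep Cond (C · z · x · y) x
  rK    : ∀ x y → CStep Cond (K · x · y) x
  rS    : ∀ x y z → CStep Cond (S · x · y · z) (x · z · (y · z))
  appL  : ∀ {t t'} u → CStep Cond t t' → CStep Cond (t · u) (t' · u)
  appR  : ∀ t {u u'} → CStep Cond u u' → CStep Cond (t · u) (t · u')

StepLevel : ℕ → ITerm → ITerm → Set
StepLevel 0       = CStep (λ _ _ → ⊥)
StepLevel (suc n) = CStep (EqClosure (StepLevel n))

_→CLC_ : ITerm → ITerm → Set
t →CLC u = ∃ λ n → StepLevel n t u

_=CLC_ : ITerm → ITerm → Set
_=CLC_ = EqClosure _→CLC_

-- Sˡ m₀ (m₁ ∷ … ∷ mₖ) denotes S^{m₀+1, m₁+1, …, mₖ+1}; the List⁺ ensures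
-- k ≥ 1 and the "+1" encoding ensures all labels are positive integers.
-- tup t₁ t₂ ts denotes the tuple ⟨t₁, t₂, ts…⟩ (length ≥ 2).

data LTerm : Set where
  var : ℕ → LTerm
  C T F K S : LTerm
  C₁ C₂ T₁ F₁ K₁ : LTerm
  Sˡ : ℕ → List⁺ ℕ → LTerm
  _·_ : LTerm → LTerm → LTerm
  tup : LTerm → LTerm → List LTerm → LTerm

⟨_⟩ : List⁺ LTerm → LTerm
⟨ t ∷ [] ⟩     = t
⟨ t ∷ u ∷ us ⟩ = tup t u us

∣_∣ : LTerm → ITerm
∣ var x ∣     = var x
∣ C ∣         = C
∣ T ∣         = T
∣ F ∣         = F
∣ K ∣         = K
∣ S ∣         = S
∣ C₁ ∣        = C
∣ C₂ ∣        = C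
∣ T₁ ∣        = T
∣ F₁ ∣        = F
∣ K₁ ∣        = K
∣ Sˡ _ _ ∣    = S
∣ t · u ∣     = ∣ t ∣ · ∣ u ∣
∣ tup t _ _ ∣ = ∣ t ∣

AllConv : List LTerm → Set
AllConv ts = ∀ {a b} → a ∈ ts → b ∈ ts → ∣ a ∣ =CLC ∣ b ∣

mutual
  data _→s_ : LTerm → LTerm → Set where
    rC₁T₁ : ∀ x y → (C₁ · T₁ · x · y) →s x
    rC₁F₁ : ∀ x y → (C₁ · F₁ · x · y) →s y
    rC₂eq : ∀ z x y → ∣ x ∣ =CLC ∣ y ∣ → (C₂ · z · x · y) →s x
    rC₂T  : ∀ x y → (C₂ · T · x · y) →s x
    rC₂F  : ∀ x y → (C₂ · F · x · y) →s y
    rC₂T₁ : ∀ x y → (C₂ · T₁ · x · y) →s x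
    rC₂F₁ : ∀ x y → (C₂ · F₁ · x · y) →s y
    rK₁   : ∀ x y → (K₁ · x · y) →s x
    -- S^{n₀,…,nₖ} x ⟨y₁,…,yₖ⟩ ⟨z₀…, z₁…, …, zₖ…⟩
    --   → x ⟨z₀…⟩ ⟨y₁⟨z₁…⟩, …, yₖ⟨zₖ…⟩⟩
    -- z₀ is the block of n₀ = m₀+1 terms; gs lists the pairs (yᵢ , zᵢ-block),
    -- where block i has nᵢ = mᵢ+1 terms.
    rSˡ   : ∀ m₀ ms x (z₀ : List⁺ LTerm) (gs : List⁺ (LTerm × List⁺ LTerm)) →
            L⁺.length z₀ ≡ suc m₀ →
            L⁺.map (λ g → L⁺.length (proj₂ g)) gs ≡ L⁺.map suc ms →
            AllConv (toList (z₀ ⁺++⁺ L⁺.concat (L⁺.map proj₂ gs))) →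
            AllConv (toList (L⁺.map proj₁ gs)) →
            (Sˡ m₀ ms · x · ⟨ L⁺.map proj₁ gs ⟩ · ⟨ z₀ ⁺++⁺ L⁺.concat (L⁺.map proj₂ gs) ⟩)
              →s (x · ⟨ z₀ ⟩ · ⟨ L⁺.map (λ g → proj₁ g · ⟨ proj₂ g ⟩) gs ⟩)
    appL  : ∀ {t t'} u → t →s t' → (t · u) →s (t' · u)
    appR  : ∀ t {u u'} → u →s u' → (t · u) →s (t · u')
    inTup : ∀ {t u us t' u' us'} →
            ListStep (t ∷ u ∷ us) (t' ∷ u' ∷ us') → tup t u us →s tup t' u' us'

  data ListStep : List LTerm → List LTerm → Set where
    here  : ∀ {t t'} ts → t →s t' → ListStep (t ∷ ts) (t' ∷ ts)
    there : ∀ t {ts ts'} → ListStep ts ts' → ListStep (t ∷ ts) (t ∷ ts')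

module Submission where

-- Every rule of CLC_s consumes exactly one occurrence of a labelled head C₁, C₂, K₁ or S^n
-- and copies nothing: the labelled S-rule distributes the z's over the blocks of the tuple
-- instead of duplicating them.  So the number of labelled heads strictly decreases along
-- every s-contraction, and an infinite reduction would be an infinite descent in ℕ.

open import Defs
open import Algebra.Properties.CommutativeSemigroup using (interchange)
open import Data.List as List using (List; []; _∷_; _++_)
open import Data.List.NonEmpty as L⁺ using (List⁺; _∷_; toList; _⁺++⁺_)
open import Data.Nat using (ℕ; suc; _+_; _<_; s≤s)
open import Data.Nat.Induction using (<-wellFounded)
open import Data.Nat.Properties
  using (+-commutativeSemigroup; +-assoc; +-identityʳ; ≤-reflexive; ≤-trans; m≤m+n; m≤n+m; +-monoˡ-<; +-monoʳ-<)
open import Data.Product using (∃; _×_; _,_; proj₁; proj₂)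
open import Induction.InfiniteDescent using (InfiniteDescendingSequence)
open import Induction.WellFounded using (WellFounded; Acc; acc)
open import Relation.Binary.Core using (Rel)
open import Relation.Binary.PropositionalEquality using (_≡_; refl; sym; cong; cong₂; module ≡-Reasoning)
open import Relation.Nullary using (¬_)

acc⇒noInfiniteDescent : ∀ {a r} {A : Set a} {_≺_ : Rel A r} (f : ℕ → A) →
                        Acc _≺_ (f 0) → ¬ InfiniteDescendingSequence _≺_ f
acc⇒noInfiniteDescent f (acc rs) descent =
  acc⇒noInfiniteDescent (λ n → f (suc n)) (rs (descent 0)) (λ n → descent (suc n))

wf⇒noInfiniteDescent : ∀ {a r} {A : Set a} {_≺_ : Rel A r} →
                       WellFounded _≺_ → ¬ ∃ (InfiniteDescendingSequence _≺_)
wf⇒noInfiniteDescent wf (f , descent) = acc⇒noInfiniteDescent f (wf (f 0)) descent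

mutual
  weight : LTerm → ℕ
  weight C₁           = 1
  weight C₂           = 1
  weight K₁           = 1
  weight (Sˡ _ _)     = 1
  weight (t · u)      = weight t + weight u
  weight (tup t u us) = weight t + (weight u + weights us)
  weight _            = 0

  weights : List LTerm → ℕ
  weights []       = 0
  weights (t ∷ ts) = weight t + weights ts

weight-⟨⟩ : ∀ ts → weight ⟨ ts ⟩ ≡ weights (toList ts)
weight-⟨⟩ (t ∷ [])     = sym (+-identityʳ (weight t))
weight-⟨⟩ (t ∷ u ∷ us) = refl

weights-++ : ∀ ts us → weights (ts ++ us) ≡ weights ts + weights us
weights-++ []       us = refl
weights-++ (t ∷ ts) us = begin
  weight t + weights (ts ++ us)         ≡⟨ cong (weight t +_) (weights-++ ts us) ⟩
  weight t + (weights ts + weights us)  ≡⟨ sym (+-assoc (weight t) _ _) ⟩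
  weight t + weights ts + weights us    ∎
  where open ≡-Reasoning

weight-⟨⁺++⁺⟩ : ∀ ts us → weight ⟨ ts ⁺++⁺ us ⟩ ≡ weight ⟨ ts ⟩ + weight ⟨ us ⟩
weight-⟨⁺++⁺⟩ ts us = begin
  weight ⟨ ts ⁺++⁺ us ⟩                     ≡⟨ weight-⟨⟩ (ts ⁺++⁺ us) ⟩
  weights (toList ts ++ toList us)          ≡⟨ weights-++ (toList ts) (toList us) ⟩
  weights (toList ts) + weights (toList us) ≡⟨ sym (cong₂ _+_ (weight-⟨⟩ ts) (weight-⟨⟩ us)) ⟩
  weight ⟨ ts ⟩ + weight ⟨ us ⟩             ∎
  where open ≡-Reasoning

Block : Set
Block = LTerm × List⁺ LTerm

applyBlock : Block → LTerm
applyBlock (y , zs) = y · ⟨ zs ⟩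

weights-map-applyBlock : ∀ (bs : List Block) →
  weights (List.map applyBlock bs)
    ≡ weights (List.map proj₁ bs) + weights (List.concat (List.map toList (List.map proj₂ bs)))
weights-map-applyBlock []              = refl
weights-map-applyBlock ((y , zs) ∷ bs) = begin
  (weight y + weight ⟨ zs ⟩) + weights (List.map applyBlock bs)
    ≡⟨ cong₂ (λ w v → (weight y + w) + v) (weight-⟨⟩ zs) (weights-map-applyBlock bs) ⟩
  (weight y + weights (toList zs)) + (weights (List.map proj₁ bs) + weights zss)
    ≡⟨ interchange +-commutativeSemigroup (weight y) _ _ _ ⟩
  (weight y + weights (List.map proj₁ bs)) + (weights (toList zs) + weights zss)
    ≡⟨ cong (weight y + weights (List.map proj₁ bs) +_) (sym (weights-++ (toList zs) zss)) ⟩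
  (weight y + weights (List.map proj₁ bs)) + weights (toList zs ++ zss)
    ∎
  where
  open ≡-Reasoning
  zss : List LTerm
  zss = List.concat (List.map toList (List.map proj₂ bs))

weight-⟨map-applyBlock⟩ : ∀ (bs : List⁺ Block) →
  weight ⟨ L⁺.map applyBlock bs ⟩
    ≡ weight ⟨ L⁺.map proj₁ bs ⟩ + weight ⟨ L⁺.concat (L⁺.map proj₂ bs) ⟩
weight-⟨map-applyBlock⟩ bs = begin
  weight ⟨ L⁺.map applyBlock bs ⟩
    ≡⟨ weight-⟨⟩ (L⁺.map applyBlock bs) ⟩
  weights (List.map applyBlock (toList bs))
    ≡⟨ weights-map-applyBlock (toList bs) ⟩
  weights (toList (L⁺.map proj₁ bs)) + weights (toList (L⁺.concat (L⁺.map proj₂ bs)))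
    ≡⟨ sym (cong₂ _+_ (weight-⟨⟩ (L⁺.map proj₁ bs)) (weight-⟨⟩ (L⁺.concat (L⁺.map proj₂ bs)))) ⟩
  weight ⟨ L⁺.map proj₁ bs ⟩ + weight ⟨ L⁺.concat (L⁺.map proj₂ bs) ⟩
    ∎
  where open ≡-Reasoning

m<1+k+m+n : ∀ k m n → m < suc k + m + n
m<1+k+m+n k m n = s≤s (≤-trans (m≤n+m m k) (m≤m+n (k + m) n))

n<1+k+m+n : ∀ k m n → n < suc k + m + n
n<1+k+m+n k m n = s≤s (m≤n+m n (k + m))

mutual
  weight-decreases : ∀ {t t′} → t →s t′ → weight t′ < weight t
  weight-decreases (rC₁T₁ x y)     = m<1+k+m+n 0 (weight x) (weight y)
  weight-decreases (rC₁F₁ x y)     = n<1+k+m+n 0 (weight x) (weight y)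
  weight-decreases (rC₂eq z x y _) = m<1+k+m+n (weight z) (weight x) (weight y)
  weight-decreases (rC₂T x y)      = m<1+k+m+n 0 (weight x) (weight y)
  weight-decreases (rC₂F x y)      = n<1+k+m+n 0 (weight x) (weight y)
  weight-decreases (rC₂T₁ x y)     = m<1+k+m+n 0 (weight x) (weight y)
  weight-decreases (rC₂F₁ x y)     = n<1+k+m+n 0 (weight x) (weight y)
  weight-decreases (rK₁ x y)       = m<1+k+m+n 0 (weight x) (weight y)
  weight-decreases (rSˡ _ _ x z₀ bs _ _ _ _) = s≤s (≤-reflexive (begin
    (weight x + weight ⟨ z₀ ⟩) + weight ⟨ L⁺.map applyBlock bs ⟩
      ≡⟨ cong (weight x + weight ⟨ z₀ ⟩ +_) (weight-⟨map-applyBlock⟩ bs) ⟩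
    (weight x + weight ⟨ z₀ ⟩) + (weight ⟨ ys ⟩ + weight ⟨ zs ⟩)
      ≡⟨ interchange +-commutativeSemigroup (weight x) _ _ _ ⟩
    (weight x + weight ⟨ ys ⟩) + (weight ⟨ z₀ ⟩ + weight ⟨ zs ⟩)
      ≡⟨ cong (weight x + weight ⟨ ys ⟩ +_) (sym (weight-⟨⁺++⁺⟩ z₀ zs)) ⟩
    (weight x + weight ⟨ ys ⟩) + weight ⟨ z₀ ⁺++⁺ zs ⟩
      ∎))
    where
    open ≡-Reasoning
    ys zs : List⁺ LTerm
    ys = L⁺.map proj₁ bs
    zs = L⁺.concat (L⁺.map proj₂ bs)
  weight-decreases (appL u s)      = +-monoˡ-< (weight u) (weight-decreases s)
  weight-decreases (appR t s)      = +-monoʳ-< (weight t) (weight-decreases s)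
  weight-decreases (inTup s)       = weights-decrease s

  weights-decrease : ∀ {ts ts′} → ListStep ts ts′ → weights ts′ < weights ts
  weights-decrease (here ts s) = +-monoˡ-< (weights ts) (weight-decreases s)
  weights-decrease (there t s) = +-monoʳ-< (weight t) (weights-decrease s)

mainTheorem8 : ¬ (∃ λ (t : ℕ → LTerm) → ∀ i → t i →s t (suc i))
mainTheorem8 (t , steps) =
  wf⇒noInfiniteDescent <-wellFounded ((λ i → weight (t i)) , λ i → weight-decreases (steps i))
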